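{- Let $S$ be a numerical semigroup. Then the associated semigroup $A(\widetilde{S})$ of its complement has at most one small atom. Moreover, if $S$ has more than one small atom, then $A(\widetilde{S})$ has no small atoms.
   Context: $\mathbb{N}=\{0,1,2,\dots\}$. A numerical set is a subset $S\subseteq\mathbb{N}$ with $0\in S$ and $\mathbb{N}\setminus S$ finite. Its gaps are the elements of $\mathbb{N}\setminus S$, and $F(S)$ is the largest gap, with $F(\mathbb{N})=-1$. A numerical semigroup is a numerical set closed under addition. The associated semigroup of a numerical set $S$ is $A(S)=\{s\in S\mid s+S\subseteq S\}$; it is a numerical semigroup with $F(A(S))=F(S)$. An atom of a numerical semigroup $T$ is a positive element of $T$ that is not a sum of two positive elements of $T$. A small atom is an atom smaller than $F(T)$. For $S\neq\mathbb{N}$, the base is $B(S)=\max\{s\in S\mid s<F(S)\}$. Young diagram of $S$: it has one left-justified row for each gap $\ell$. The top row corresponds to $F(S)$, and the gaps decrease going down. The row for $\ell$ has length $|\{s\in S\mid s<\ell\}|$. This is a bijection between numerical sets and Young diagrams, with $\mathbb{N}$ corresponding to the empty diagram. The complement of a Young diagram with rows $\lambda_1\ge\dots\ge\lambda_g$ has rows $\lambda_1-\lambda_g\ge\dots\ge\lambda_1-\lambda_1$, zero rows being discarded. Geometrically, this is the rest of the $g\times\lambda_1$ rectangle rotated by $180^\circ$. The complement $\widetilde{S}$ is the numerical set whose Young diagram is the complement of that of $S$. One has $\widetilde{\mathbb{N}}=\mathbb{N}$, and for $S\neq\mathbb{N}$ equivalently $\widetilde{S}=\{B(S)-s\mid s\in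 S,\ s\le B(S)\}\cup\{n\mid n\ge B(S)\}$. -}

module Defs where

open import Data.Nat using (ℕ; zero; suc; _+_; _∸_; _≤_; _<_; _≡ᵇ_)
open import Data.Bool using (Bool; true; false; not; _∨_)
open import Data.List using (List; []; _∷_; length; map; reverse; upTo; downFrom; filterᵇ)
open import Data.Product using (Σ; _×_; ∃; ∃-syntax)
open import Relation.Nullary using (¬_)
open import Relation.Binary.PropositionalEquality using (_≡_; _≢_)

-- Membership is given by a Boolean function; finiteness of the
-- complement is witnessed by a bound beyond which everything is in S.

record NumericalSet : Set where
  field
    mem      : ℕ → Bool
    zero∈    : mem 0 ≡ true
    bound    : ℕ
    cofinite : ∀ n → bound ≤ n → mem n ≡ true
open NumericalSet public

_∈ₛ_ : ℕ → NumericalSet → Set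
n ∈ₛ S = mem S n ≡ true

⟦_⟧ : NumericalSet → ℕ → Set
⟦ S ⟧ n = n ∈ₛ S

IsNumericalSemigroup : NumericalSet → Set
IsNumericalSemigroup S = ∀ a b → a ∈ₛ S → b ∈ₛ S → (a + b) ∈ₛ S

Assoc : (ℕ → Set) → ℕ → Set
Assoc P s = P s × (∀ t → P t → P (s + t))

IsAtom : (ℕ → Set) → ℕ → Set
IsAtom P a = P a × 0 < a ×
  ¬ (∃[ b ] ∃[ c ] (0 < b × 0 < c × P b × P c × b + c ≡ a))

-- small atom: an atom a with a < F(T), i.e. some gap of T exceeds a
-- (F(T) is the largest gap, and F(T) = -1 when T has no gaps)
IsSmallAtom : (ℕ → Set) → ℕ → Set
IsSmallAtom P a = IsAtom P a × ∃[ g ] (¬ P g × a < g)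

-- Young diagrams (list of row lengths, top row first)

-- gaps of S in decreasing order (top row corresponds to F(S))
gapsOf : NumericalSet → List ℕ
gapsOf S = filterᵇ (λ n → not (mem S n)) (downFrom (bound S))

rowLength : NumericalSet → ℕ → ℕ
rowLength S ℓ = length (filterᵇ (mem S) (upTo ℓ))

young : NumericalSet → List ℕ
young S = map (rowLength S) (gapsOf S)

complementDiagram : List ℕ → List ℕ
complementDiagram []        = []
complementDiagram (l ∷ ls) =
  filterᵇ (λ r → not (r ≡ᵇ 0)) (map (l ∸_) (reverse (l ∷ ls)))

-- inverse of the Young-diagram bijection: for rows μ₁ ≥ … ≥ μ_g
-- the gaps are μ_i + (g - i)
diagramGaps : List ℕ → List ℕ
diagramGaps []       = []
diagramGaps (m ∷ ms) = (m + length ms) ∷ diagramGaps ms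

elemᵇ : ℕ → List ℕ → Bool
elemᵇ n []       = false
elemᵇ n (x ∷ xs) = (n ≡ᵇ x) ∨ elemᵇ n xs

diagramMem : List ℕ → ℕ → Bool
diagramMem μ n = not (elemᵇ n (diagramGaps μ))

Complement : NumericalSet → ℕ → Set
Complement S n = diagramMem (complementDiagram (young S)) n ≡ true

module Submission where

-- Let B be the base of S (B = 0 when S = ℕ). Reading gaps off the complement diagram gives
-- S̃ = {n | B ∸ n ∈ S}: the top block of gaps of S only adds zero rows, and the gap y < B of S
-- becomes the gap B − y of S̃. Hence A(S̃) contains every n ≥ B, so its small atoms lie below B,
-- and any x ∈ A(S̃) satisfies s − x ∈ S for every s ≤ B in S. If m is the multiplicity of S,
-- this forces every x ∈ A(S̃) below B to be a multiple of m, and a positive such x forces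
-- every element of S up to B to be a multiple of m. Then every multiple of m lies in A(S̃),
-- so a small atom of A(S̃) and, in its presence, every small atom of S (which lies below B)
-- is an atom that is a multiple of m, i.e. equals m.

open import Defs
open import Data.Bool as Bool using (Bool; true; false; not; T)
open import Data.Bool.Properties using (¬-not)
open import Data.Empty using (⊥-elim)
open import Data.List
  using (List; []; _∷_; _++_; _∷ʳ_; [_]; length; map; reverse; filter; filterᵇ; upTo; downFrom; applyDownFrom)
open import Data.List.Properties
  using (map-∘; map-cong-local; reverse-map; unfold-reverse; ∷-injectiveˡ; ++-identityʳ; length-++;
         filter-++; upTo-∷ʳ; length-applyDownFrom)
open import Data.List.Membership.Propositional using (_∈_; _∉_)
open import Data.List.Membership.Propositional.Properties
  using (∈-map⁺; ∈-map⁻; ∈-++⁺ˡ; ∈-++⁻; ∈-filter⁺; ∈-filter⁻; ∈-downFrom⁺; ∈-downFrom⁻)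
open import Data.List.Relation.Unary.All as All using (All; []; _∷_)
open import Data.List.Relation.Unary.Any using (here; there)
open import Data.List.Relation.Unary.Any.Properties using (reverse⁺; reverse⁻)
open import Data.Nat
open import Data.Nat.Properties
open import Data.Nat.DivMod using (_/_; _%_; m%n<n; m/n*n≤m; m≡m%n+[m/n]*n)
open import Data.Nat.Divisibility
  using (_∣_; quotient; divides; divides-refl; ∣-refl; n∣m*n; ∣m∸n∣n⇒∣m; m%n≡0⇒n∣m)
open import Data.Nat.Induction using (<-rec)
open import Data.Product using (_×_; _,_; proj₁; proj₂; ∃-syntax)
open import Data.Sum using (_⊎_; inj₁; inj₂)
open import Data.Unit using (⊤)
open import Function using (_∘_; case_of_; _⇔_; mk⇔; Equivalence)
open import Relation.Binary.PropositionalEquality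
  using (_≡_; _≢_; refl; sym; trans; cong; cong₂; subst; module ≡-Reasoning)
open import Relation.Nullary using (¬_; contradiction; does; yes; no)
open import Relation.Nullary.Decidable using (T?; _×-dec_)
open import Relation.Unary using (Pred; Decidable)

filter-reverse : ∀ {a p} {A : Set a} {P : Pred A p} (P? : Decidable P) xs →
  filter P? (reverse xs) ≡ reverse (filter P? xs)
filter-reverse P? []       = refl
filter-reverse P? (x ∷ xs)
  rewrite unfold-reverse x xs | filter-++ P? (reverse xs) [ x ] | filter-reverse P? xs
  with does (P? x)
... | true  = sym (unfold-reverse x (filter P? xs))
... | false = ++-identityʳ _

∣m∣n⇒∣m∸n : ∀ {d m n} → d ∣ m → d ∣ n → d ∣ m ∸ n
∣m∣n⇒∣m∸n {d} (divides-refl p) (divides-refl q) = divides (p ∸ q) (sym (*-distribʳ-∸ d p q))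

atom-multiple≡ : ∀ {P : ℕ → Set} {m a} → (∀ {n} → m ∣ n → P n) → 0 < m →
                 IsAtom P a → m ∣ a → a ≡ m
atom-multiple≡             _       _   (_ , a>0 , _) (divides-refl 0) = contradiction a>0 (<-irrefl refl)
atom-multiple≡ {m = m}     _       _   _             (divides-refl 1) = +-identityʳ m
atom-multiple≡ {m = m} multiples∈P m>0 (_ , _ , irreducible) (divides-refl (suc (suc k))) =
  ⊥-elim (irreducible (m , suc k * m , m>0 , <-≤-trans m>0 (m≤m+n m (k * m)) ,
               multiples∈P ∣-refl , multiples∈P (n∣m*n (suc k)) , refl))

leastBelow : ∀ {p} {P : ℕ → Set p} → Decidable P → ∀ N →
  (∃[ m ] (m < N × P m × ∀ {k} → k < m → ¬ P k)) ⊎ (∀ {k} → k < N → ¬ P k)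
leastBelow P? zero = inj₂ λ ()
leastBelow P? (suc N) with leastBelow P? N
... | inj₁ (m , m<N , Pm , minimal) = inj₁ (m , m<n⇒m<1+n m<N , Pm , minimal)
... | inj₂ none with P? N
...   | yes PN = inj₁ (N , ≤-refl , PN , none)
...   | no ¬PN = inj₂ λ k<1+N → case m<1+n⇒m<n∨m≡n k<1+N of λ
  { (inj₁ k<N)  → none k<N
  ; (inj₂ refl) → ¬PN }

least : ∀ {p} {P : ℕ → Set p} → Decidable P → ∀ {n} → P n →
        ∃[ m ] (P m × ∀ {k} → k < m → ¬ P k)
least P? {n} Pn with leastBelow P? (suc n)
... | inj₁ (m , _ , Pm , minimal) = m , Pm , minimal
... | inj₂ none = contradiction Pn (none ≤-refl)

elemᵇ⇒∈ : ∀ {n} xs → elemᵇ n xs ≡ true → n ∈ xs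
elemᵇ⇒∈ {n} (x ∷ xs) e with n ≡ᵇ x in n≡ᵇx
... | true  = here (≡ᵇ⇒≡ n x (subst T (sym n≡ᵇx) _))
... | false = there (elemᵇ⇒∈ xs e)

∈⇒elemᵇ : ∀ {n xs} → n ∈ xs → elemᵇ n xs ≡ true
∈⇒elemᵇ {n} (here refl) with n ≡ᵇ n in n≡ᵇn
... | true  = refl
... | false = ⊥-elim (subst T n≡ᵇn (≡⇒≡ᵇ n n refl))
∈⇒elemᵇ {n} {x ∷ _} (there n∈) with n ≡ᵇ x
... | true  = refl
... | false = ∈⇒elemᵇ n∈

diagramMem⇔∉ : ∀ μ n → diagramMem μ n ≡ true ⇔ n ∉ diagramGaps μ
diagramMem⇔∉ μ n with elemᵇ n (diagramGaps μ) in e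
... | true  = mk⇔ (λ ()) (λ n∉ → contradiction (elemᵇ⇒∈ _ e) n∉)
... | false = mk⇔ (λ _ n∈ → contradiction (trans (sym (∈⇒elemᵇ n∈)) e) λ ()) (λ _ → refl)

diagramGaps-∷ʳ : ∀ xs x → diagramGaps (xs ∷ʳ x) ≡ map suc (diagramGaps xs) ∷ʳ x
diagramGaps-∷ʳ []       x = cong [_] (+-identityʳ x)
diagramGaps-∷ʳ (m ∷ ms) x =
  cong₂ _∷_ (trans (cong (m +_) (trans (length-++ ms) (+-comm _ 1))) (+-suc m _)) (diagramGaps-∷ʳ ms x)

-- Gaps and Young diagrams

gapsBelow : NumericalSet → ℕ → List ℕ
gapsBelow S n = filterᵇ (λ k → not (mem S k)) (downFrom n)

rowsOf : List ℕ → List ℕ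
rowsOf []       = []
rowsOf (g ∷ gs) = g ∸ length gs ∷ rowsOf gs

gapRun : ℕ → ℕ → List ℕ
gapRun B = applyDownFrom (λ i → suc i + B)

∈-gapRun⁺ : ∀ {B s} k → B < s → s ≤ k + B → s ∈ gapRun B k
∈-gapRun⁺ zero    B<s s≤B = contradiction s≤B (<⇒≱ B<s)
∈-gapRun⁺ {B} {s} (suc k) B<s s≤ with s ≟ suc k + B
... | yes refl = here refl
... | no  s≢   = there (∈-gapRun⁺ k B<s (≤-pred (≤∧≢⇒< s≤ s≢)))

∈-gapRun⁻ : ∀ {B g} k → g ∈ gapRun B k → g ≤ k + B
∈-gapRun⁻ (suc k) (here refl) = ≤-refl
∈-gapRun⁻ (suc k) (there g∈)  = m≤n⇒m≤1+n (∈-gapRun⁻ k g∈)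

module _ (S : NumericalSet) where

  ∈-gapsBelow⁺ : ∀ {n y} → y < n → ¬ y ∈ₛ S → y ∈ gapsBelow S n
  ∈-gapsBelow⁺ y<n y∉S =
    ∈-filter⁺ (T? ∘ λ k → not (mem S k)) (∈-downFrom⁺ y<n) (subst (T ∘ not) (sym (¬-not y∉S)) _)

  ∈-gapsBelow⁻ : ∀ {n y} → y ∈ gapsBelow S n → y < n × ¬ y ∈ₛ S
  ∈-gapsBelow⁻ {n} {y} y∈ with ∈-filter⁻ (T? ∘ λ k → not (mem S k)) {xs = downFrom n} y∈
  ... | y∈ₙ , gap = ∈-downFrom⁻ y∈ₙ , λ y∈S → subst (T ∘ not) y∈S gap

  rowLength-suc : ∀ n → rowLength S (suc n) ≡ rowLength S n + length (filterᵇ (mem S) [ n ])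
  rowLength-suc n = begin
    length (filterᵇ (mem S) (upTo (suc n)))
      ≡⟨ cong (length ∘ filterᵇ (mem S)) (upTo-∷ʳ n) ⟨
    length (filterᵇ (mem S) (upTo n ++ [ n ]))
      ≡⟨ cong length (filter-++ (T? ∘ mem S) (upTo n) [ n ]) ⟩
    length (filterᵇ (mem S) (upTo n) ++ filterᵇ (mem S) [ n ])
      ≡⟨ length-++ (filterᵇ (mem S) (upTo n)) ⟩
    rowLength S n + length (filterᵇ (mem S) [ n ]) ∎
    where open ≡-Reasoning

  rowLength-suc-∈ : ∀ {n} → n ∈ₛ S → rowLength S (suc n) ≡ suc (rowLength S n)
  rowLength-suc-∈ {n} n∈S rewrite rowLength-suc n | n∈S = +-comm (rowLength S n) 1

  rowLength-suc-∉ : ∀ {n} → mem S n ≡ false → rowLength S (suc n) ≡ rowLength S n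
  rowLength-suc-∉ {n} n∉S rewrite rowLength-suc n | n∉S = +-identityʳ (rowLength S n)

  rowLength+gapCount : ∀ n → rowLength S n + length (gapsBelow S n) ≡ n
  rowLength+gapCount zero = refl
  rowLength+gapCount (suc n) with mem S n in e
  ... | true  rewrite rowLength-suc-∈ e = cong suc (rowLength+gapCount n)
  ... | false rewrite rowLength-suc-∉ e =
    trans (+-suc (rowLength S n) _) (cong suc (rowLength+gapCount n))

  rowLength≡ : ∀ n → rowLength S n ≡ n ∸ length (gapsBelow S n)
  rowLength≡ n = trans (sym (m+n∸n≡m (rowLength S n) gapCount)) (cong (_∸ gapCount) (rowLength+gapCount n))
    where gapCount = length (gapsBelow S n)

  young-rowsOf : ∀ n → map (rowLength S) (gapsBelow S n) ≡ rowsOf (gapsBelow S n)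
  young-rowsOf zero = refl
  young-rowsOf (suc n) with mem S n
  ... | true  = young-rowsOf n
  ... | false = cong₂ _∷_ (rowLength≡ n) (young-rowsOf n)

  TopGaps : ℕ → Set
  TopGaps n = gapsBelow S n ≡ []
            ⊎ ∃[ B ] ∃[ z ] (B ∈ₛ S × gapsBelow S n ≡ gapRun B (suc z) ++ gapsBelow S B)

  topGaps : ∀ n → TopGaps n
  topGaps zero    = inj₁ refl
  topGaps (suc n) with topGaps n | mem S n in e
  ... | ih | true = ih
  topGaps (suc zero)    | _  | false = contradiction (trans (sym (zero∈ S)) e) λ ()
  topGaps (suc (suc k)) | ih | false with mem S k in e′
  ... | true  = inj₂ (k , 0 , e′ , refl)
  -- no inj₁ case: the gaps below suc k start with the gap k
  ... | false with ih
  ...   | inj₂ (B , z , B∈S , split) =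
    inj₂ (B , suc z , B∈S , cong₂ _∷_ (cong suc (∷-injectiveˡ split)) split)

  length-gapsBelow≤ : ∀ n → length (gapsBelow S n) ≤ n
  length-gapsBelow≤ n = subst (length (gapsBelow S n) ≤_) (rowLength+gapCount n) (m≤n+m _ (rowLength S n))

  gap<bound : ∀ {g} → ¬ g ∈ₛ S → g < bound S
  gap<bound {g} g∉S with g <? bound S
  ... | yes g<b = g<b
  ... | no  g≮b = contradiction (cofinite S g (≮⇒≥ g≮b)) g∉S

  gap∈gapsOf : ∀ {g} → ¬ g ∈ₛ S → g ∈ gapsOf S
  gap∈gapsOf g∉S = ∈-gapsBelow⁺ (gap<bound g∉S) g∉S

-- The complement diagram

-- The rows of the complement diagram coming from the gaps below the base, listed bottom-up.
complementRows : ℕ → ℕ → List ℕ → List ℕ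
complementRows B i []       = []
complementRows B i (y ∷ ys) = B ∸ (i + y) ∷ complementRows B (suc i) ys

-- Fits makes both subtractions exact: the row y ∸ length ys and the complement row B ∸ (i + y).
Fits : ℕ → ℕ → List ℕ → Set
Fits B i []       = ⊤
Fits B i (y ∷ ys) = length ys ≤ y × i + y < B × Fits B (suc i) ys

Fits⇒bounded : ∀ {B i} L → Fits B i L → All (λ y → i + y < B) L
Fits⇒bounded []       _                  = []
Fits⇒bounded (y ∷ ys) (_ , i+y<B , fits) =
  i+y<B ∷ All.map (≤-trans (s≤s (n≤1+n _))) (Fits⇒bounded ys fits)

diagramGaps-complementRows : ∀ B i L → Fits B i L →
  diagramGaps (reverse (complementRows B i L)) ≡ reverse (map (λ y → B ∸ (i + y)) L)
diagramGaps-complementRows B i []       _ = refl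
diagramGaps-complementRows B i (y ∷ ys) fits@(_ , _ , fits′) = begin
  diagramGaps (reverse (B ∸ (i + y) ∷ complementRows B (suc i) ys))
    ≡⟨ cong diagramGaps (unfold-reverse _ (complementRows B (suc i) ys)) ⟩
  diagramGaps (reverse (complementRows B (suc i) ys) ∷ʳ (B ∸ (i + y)))
    ≡⟨ diagramGaps-∷ʳ (reverse (complementRows B (suc i) ys)) _ ⟩
  map suc (diagramGaps (reverse (complementRows B (suc i) ys))) ∷ʳ (B ∸ (i + y))
    ≡⟨ cong (λ gs → map suc gs ∷ʳ (B ∸ (i + y))) (diagramGaps-complementRows B (suc i) ys fits′) ⟩
  map suc (reverse (map (λ y → B ∸ (suc i + y)) ys)) ∷ʳ (B ∸ (i + y))
    ≡⟨ cong (_∷ʳ (B ∸ (i + y))) (reverse-map suc (map (λ y → B ∸ (suc i + y)) ys)) ⟩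
  reverse (map suc (map (λ y → B ∸ (suc i + y)) ys)) ∷ʳ (B ∸ (i + y))
    ≡⟨ cong (λ gs → reverse gs ∷ʳ (B ∸ (i + y))) shift ⟩
  reverse (map (λ y → B ∸ (i + y)) ys) ∷ʳ (B ∸ (i + y))
    ≡⟨ unfold-reverse _ (map (λ y → B ∸ (i + y)) ys) ⟨
  reverse (map (λ y → B ∸ (i + y)) (y ∷ ys)) ∎
  where
  open ≡-Reasoning
  shift : map suc (map (λ y → B ∸ (suc i + y)) ys) ≡ map (λ y → B ∸ (i + y)) ys
  shift = trans (sym (map-∘ ys)) (map-cong-local (All.map (λ lt → sym (+-∸-assoc 1 lt))
                                                          (All.tail (Fits⇒bounded (y ∷ ys) fits))))

nonzero : ℕ → Bool
nonzero r = not (r ≡ᵇ 0)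

filter-nonzero-∷ : ∀ {x} xs → 0 < x → filterᵇ nonzero (x ∷ xs) ≡ x ∷ filterᵇ nonzero xs
filter-nonzero-∷ xs (s≤s _) = refl

complementRow≡ : ∀ {B l i k y} → l + suc k + i ≡ suc B → k ≤ y → l ∸ (y ∸ k) ≡ B ∸ (i + y)
complementRow≡ {B} {l} {i} {k} {y} eq k≤y = sym (begin
  B ∸ (i + y)                         ≡⟨ cong₂ _∸_ B≡ i+y≡ ⟩
  (k + i + l) ∸ (k + i + (y ∸ k))     ≡⟨ [m+n]∸[m+o]≡n∸o (k + i) l (y ∸ k) ⟩
  l ∸ (y ∸ k)                         ∎)
  where
  open ≡-Reasoning
  B≡ : B ≡ k + i + l
  B≡ = trans (suc-injective (trans (sym eq) (cong (_+ i) (+-suc l k))))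
             (trans (+-assoc l k i) (+-comm l (k + i)))
  i+y≡ : i + y ≡ k + i + (y ∸ k)
  i+y≡ = trans (cong (i +_) (sym (m+[n∸m]≡n k≤y)))
               (trans (sym (+-assoc i k (y ∸ k))) (cong (_+ (y ∸ k)) (+-comm i k)))

complementRows-rowsOf : ∀ {B} l i L → l + length L + i ≡ suc B → Fits B i L →
  filterᵇ nonzero (map (l ∸_) (rowsOf L)) ≡ complementRows B i L
complementRows-rowsOf l i []       _  _ = refl
complementRows-rowsOf {B} l i (y ∷ ys) eq (ys≤y , i+y<B , fits) = begin
  filterᵇ nonzero (l ∸ (y ∸ length ys) ∷ map (l ∸_) (rowsOf ys))
    ≡⟨ cong (λ r → filterᵇ nonzero (r ∷ map (l ∸_) (rowsOf ys))) (complementRow≡ eq ys≤y) ⟩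
  filterᵇ nonzero (B ∸ (i + y) ∷ map (l ∸_) (rowsOf ys))
    ≡⟨ filter-nonzero-∷ (map (l ∸_) (rowsOf ys)) (m<n⇒0<n∸m i+y<B) ⟩
  B ∸ (i + y) ∷ filterᵇ nonzero (map (l ∸_) (rowsOf ys))
    ≡⟨ cong (B ∸ (i + y) ∷_) (complementRows-rowsOf l (suc i) ys eq′ fits) ⟩
  B ∸ (i + y) ∷ complementRows B (suc i) ys ∎
  where
  open ≡-Reasoning
  eq′ : l + length ys + suc i ≡ suc B
  eq′ = trans (+-suc _ i) (trans (cong (_+ i) (sym (+-suc l (length ys)))) eq)

module _ (B : ℕ) (L : List ℕ) where

  runRow≡ : ∀ j → (suc j + B) ∸ length (gapRun B j ++ L) ≡ suc B ∸ length L
  runRow≡ j = begin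
    (suc j + B) ∸ length (gapRun B j ++ L) ≡⟨ cong ((suc j + B) ∸_) length≡ ⟩
    (suc j + B) ∸ (j + length L)           ≡⟨ cong (_∸ (j + length L)) (+-suc j B) ⟨
    (j + suc B) ∸ (j + length L)           ≡⟨ [m+n]∸[m+o]≡n∸o j (suc B) (length L) ⟩
    suc B ∸ length L                       ∎
    where
    open ≡-Reasoning
    length≡ : length (gapRun B j ++ L) ≡ j + length L
    length≡ = trans (length-++ (gapRun B j)) (cong (_+ length L) (length-applyDownFrom _ j))

  filter-runRows : ∀ j → filterᵇ nonzero (map ((suc B ∸ length L) ∸_) (rowsOf (gapRun B j ++ L)))
                       ≡ filterᵇ nonzero (map ((suc B ∸ length L) ∸_) (rowsOf L))
  filter-runRows zero    = refl
  filter-runRows (suc j) rewrite runRow≡ j | n∸n≡0 (suc B ∸ length L) = filter-runRows j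

  complementDiagram-split : ∀ z → length L ≤ suc B → Fits B 0 L →
    complementDiagram (rowsOf (gapRun B (suc z) ++ L)) ≡ reverse (complementRows B 0 L)
  complementDiagram-split z |L|≤ fits = begin
    filterᵇ nonzero (map (r₀ ∸_) (reverse R))  ≡⟨ cong (filterᵇ nonzero) (reverse-map (r₀ ∸_) R) ⟩
    filterᵇ nonzero (reverse (map (r₀ ∸_) R))  ≡⟨ filter-reverse (T? ∘ nonzero) (map (r₀ ∸_) R) ⟩
    reverse (filterᵇ nonzero (map (r₀ ∸_) R))
      ≡⟨ cong (λ r → reverse (filterᵇ nonzero (map (r ∸_) R))) (runRow≡ z) ⟩
    reverse (filterᵇ nonzero (map (l ∸_) R))   ≡⟨ cong reverse (filter-runRows (suc z)) ⟩
    reverse (filterᵇ nonzero (map (l ∸_) (rowsOf L)))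
      ≡⟨ cong reverse (complementRows-rowsOf l 0 L (trans (+-identityʳ _) (m∸n+n≡m |L|≤)) fits) ⟩
    reverse (complementRows B 0 L)             ∎
    where
    open ≡-Reasoning
    R  = rowsOf (gapRun B (suc z) ++ L)
    r₀ = (suc z + B) ∸ length (gapRun B z ++ L)
    l  = suc B ∸ length L

module _ (S : NumericalSet) where

  fits-gapsBelow : ∀ {B} i n → i + n ≤ B → Fits B i (gapsBelow S n)
  fits-gapsBelow         i zero    _ = _
  fits-gapsBelow {B} i (suc n) i+n≤B with mem S n
  ... | true  = fits-gapsBelow i n (≤-trans (+-monoʳ-≤ i (n≤1+n n)) i+n≤B)
  ... | false = length-gapsBelow≤ S n , i+n<B , fits-gapsBelow (suc i) n i+n<B
    where
    i+n<B : i + n < B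
    i+n<B = subst (_≤ B) (+-suc i n) i+n≤B

  -- B is the base of S, or 0 when S = ℕ; as ∸ truncates, complement⇔ puts every n ≥ B in S̃.
  record Base (B : ℕ) : Set where
    field
      base∈       : B ∈ₛ S
      complement⇔ : ∀ n → Complement S n ⇔ (B ∸ n) ∈ₛ S
      below-gap⇒≤ : ∀ {s g} → s ∈ₛ S → ¬ g ∈ₛ S → s < g → s ≤ B

  complement⇔-fromGaps : ∀ {B} → B ∈ₛ S →
    diagramGaps (complementDiagram (young S)) ≡ reverse (map (B ∸_) (gapsBelow S B)) →
    ∀ n → Complement S n ⇔ (B ∸ n) ∈ₛ S
  complement⇔-fromGaps {B} B∈S gaps n = mk⇔ to from
    where
    Complement⇔∉ : Complement S n ⇔ n ∉ reverse (map (B ∸_) (gapsBelow S B))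
    Complement⇔∉ = subst (λ gs → Complement S n ⇔ n ∉ gs) gaps (diagramMem⇔∉ _ n)

    to : Complement S n → (B ∸ n) ∈ₛ S
    to n∈S̃ with mem S (B ∸ n) in e
    ... | true  = refl
    ... | false = ⊥-elim (Equivalence.to Complement⇔∉ n∈S̃
                    (reverse⁺ (subst (_∈ map (B ∸_) (gapsBelow S B)) (m∸[m∸n]≡n n≤B)
                                     (∈-map⁺ (B ∸_) y∈))))
      where
      y∉S : ¬ (B ∸ n) ∈ₛ S
      y∉S y∈S = contradiction (trans (sym e) y∈S) λ ()
      n≤B : n ≤ B
      n≤B with n ≤? B
      ... | yes n≤B = n≤B
      ... | no  n≰B = contradiction (subst (_∈ₛ S) (sym (m≤n⇒m∸n≡0 (≰⇒≥ n≰B))) (zero∈ S)) y∉S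
      y∈ : B ∸ n ∈ gapsBelow S B
      y∈ = ∈-gapsBelow⁺ S (≤∧≢⇒< (m∸n≤m B n) λ y≡B → y∉S (subst (_∈ₛ S) (sym y≡B) B∈S))
                          y∉S

    from : (B ∸ n) ∈ₛ S → Complement S n
    from B∸n∈S = Equivalence.from Complement⇔∉ λ n∈ →
      let y , y∈ , n≡B∸y = ∈-map⁻ (B ∸_) (reverse⁻ n∈)
          y<B , y∉S = ∈-gapsBelow⁻ S {B} y∈
      in  y∉S (subst (_∈ₛ S) (trans (cong (B ∸_) n≡B∸y) (m∸[m∸n]≡n (<⇒≤ y<B))) B∸n∈S)

  complementGaps-split : ∀ {B z} → gapsOf S ≡ gapRun B (suc z) ++ gapsBelow S B →
    diagramGaps (complementDiagram (young S)) ≡ reverse (map (B ∸_) (gapsBelow S B))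
  complementGaps-split {B} {z} split = begin
    diagramGaps (complementDiagram (young S))
      ≡⟨ cong (diagramGaps ∘ complementDiagram) (trans (young-rowsOf S (bound S)) (cong rowsOf split)) ⟩
    diagramGaps (complementDiagram (rowsOf (gapRun B (suc z) ++ gapsBelow S B)))
      ≡⟨ cong diagramGaps (complementDiagram-split B (gapsBelow S B) z
                             (m≤n⇒m≤1+n (length-gapsBelow≤ S B)) fits) ⟩
    diagramGaps (reverse (complementRows B 0 (gapsBelow S B)))
      ≡⟨ diagramGaps-complementRows B 0 (gapsBelow S B) fits ⟩
    reverse (map (B ∸_) (gapsBelow S B)) ∎
    where
    open ≡-Reasoning
    fits : Fits B 0 (gapsBelow S B)
    fits = fits-gapsBelow 0 B ≤-refl

  base : ∃[ B ] Base B
  base with topGaps S (bound S)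
  ... | inj₁ noGaps = 0 , record
    { base∈       = zero∈ S
    ; complement⇔ = complement⇔-fromGaps (zero∈ S)
                      (cong (diagramGaps ∘ complementDiagram)
                            (trans (young-rowsOf S (bound S)) (cong rowsOf noGaps)))
    ; below-gap⇒≤ = λ _ g∉S _ → case subst (_ ∈_) noGaps (gap∈gapsOf S g∉S) of λ ()
    }
  ... | inj₂ (B , z , B∈S , split) = B , record
    { base∈       = B∈S
    ; complement⇔ = complement⇔-fromGaps B∈S (complementGaps-split {B} {z} split)
    ; below-gap⇒≤ = below-gap⇒≤
    }
    where
    below-gap⇒≤ : ∀ {s g} → s ∈ₛ S → ¬ g ∈ₛ S → s < g → s ≤ B
    below-gap⇒≤ {s} {g} s∈S g∉S s<g
      with ∈-++⁻ (gapRun B (suc z)) (subst (g ∈_) split (gap∈gapsOf S g∉S))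
    ... | inj₂ g∈ = <⇒≤ (<-trans s<g (proj₁ (∈-gapsBelow⁻ S {B} g∈)))
    ... | inj₁ g∈ with s ≤? B
    ...   | yes s≤B = s≤B
    ...   | no  s≰B = contradiction s∈S (proj₂ (∈-gapsBelow⁻ S {bound S} s∈gaps))
      where
      s∈gaps : s ∈ gapsOf S
      s∈gaps = subst (s ∈_) (sym split)
                 (∈-++⁺ˡ (∈-gapRun⁺ (suc z) (≰⇒> s≰B)
                                    (≤-trans (<⇒≤ s<g) (∈-gapRun⁻ (suc z) g∈))))

-- Small atoms

record IsMultiplicity (S : NumericalSet) (m : ℕ) : Set where
  field
    mult∈        : m ∈ₛ S
    mult>0       : 0 < m
    mult-minimal : ∀ {s} → s ∈ₛ S → 0 < s → m ≤ s

multiplicity : (S : NumericalSet) → ∃[ m ] IsMultiplicity S m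
multiplicity S
  with least (λ k → (0 <? k) ×-dec (mem S k Bool.≟ true)) (z<s , cofinite S (suc (bound S)) (n≤1+n _))
... | m , (m>0 , m∈S) , minimal = m , record
  { mult∈        = m∈S
  ; mult>0       = m>0
  ; mult-minimal = λ s∈S s>0 → ≮⇒≥ λ s<m → minimal s<m (s>0 , s∈S)
  }

module SmallAtoms {S : NumericalSet} (closed : IsNumericalSemigroup S)
         {B : ℕ} (isBase : Base S B) {m : ℕ} (isMult : IsMultiplicity S m) where

  open Base isBase
  open IsMultiplicity isMult

  private
    S̃ = Complement S
    instance
      m≢0 : NonZero m
      m≢0 = >-nonZero mult>0

  multiple∈ : ∀ {n} → m ∣ n → n ∈ₛ S
  multiple∈ (divides-refl q) = go q
    where
    go : ∀ q → (q * m) ∈ₛ S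
    go zero    = zero∈ S
    go (suc q) = closed m (q * m) mult∈ (go q)

  ∈∧<mult⇒≡0 : ∀ {r} → r ∈ₛ S → r < m → r ≡ 0
  ∈∧<mult⇒≡0 {zero}  _   _   = refl
  ∈∧<mult⇒≡0 {suc r} r∈S r<m = contradiction (mult-minimal r∈S z<s) (<⇒≱ r<m)

  mult∸∈⇒≡0 : ∀ {r} → r < m → (m ∸ r) ∈ₛ S → r ≡ 0
  mult∸∈⇒≡0 {zero}  _   _     = refl
  mult∸∈⇒≡0 {suc r} r<m m∸r∈S =
    contradiction (mult-minimal m∸r∈S (m<n⇒0<n∸m r<m))
                  (<⇒≱ (∸-monoʳ-< {m} {suc r} {0} z<s (<⇒≤ r<m)))

  complement-≥base : ∀ {n} → B ≤ n → S̃ n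
  complement-≥base B≤n =
    Equivalence.from (complement⇔ _) (subst (_∈ₛ S) (sym (m≤n⇒m∸n≡0 B≤n)) (zero∈ S))

  assoc-≥base : ∀ {g} → B ≤ g → Assoc S̃ g
  assoc-≥base B≤g = complement-≥base B≤g , λ t _ → complement-≥base (≤-trans B≤g (m≤m+n _ t))

  smallAtom<base : ∀ {a} → IsSmallAtom (Assoc S̃) a → a < B
  smallAtom<base (_ , g , g∉A , a<g) with B ≤? g
  ... | yes B≤g = contradiction (assoc-≥base B≤g) g∉A
  ... | no  B≰g = <-trans a<g (≰⇒> B≰g)

  -- B ∸ s lies in S̃, hence so does x + (B ∸ s), whose reflection B ∸ (x + (B ∸ s)) is s ∸ x.
  assoc-shift : ∀ {x s} → Assoc S̃ x → s ∈ₛ S → s ≤ B → (s ∸ x) ∈ₛ S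
  assoc-shift {x} {s} (_ , x+S̃⊆S̃) s∈S s≤B =
    subst (_∈ₛ S) B∸[x+t]≡s∸x (Equivalence.to (complement⇔ (x + t)) (x+S̃⊆S̃ t t∈S̃))
    where
    open ≡-Reasoning
    t = B ∸ s
    t∈S̃ : S̃ t
    t∈S̃ = Equivalence.from (complement⇔ t) (subst (_∈ₛ S) (sym (m∸[m∸n]≡n s≤B)) s∈S)
    B∸[x+t]≡s∸x : B ∸ (x + t) ≡ s ∸ x
    B∸[x+t]≡s∸x = begin
      B ∸ (x + t)   ≡⟨ cong (B ∸_) (+-comm x t) ⟩
      B ∸ (t + x)   ≡⟨ ∸-+-assoc B t x ⟨
      (B ∸ t) ∸ x   ≡⟨ cong (_∸ x) (m∸[m∸n]≡n s≤B) ⟩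
      s ∸ x         ∎

  mult+assoc≤base : ∀ {x} → Assoc S̃ x → x < B → m + x ≤ B
  mult+assoc≤base {x} (x∈S̃ , _) x<B = subst (m + x ≤_) (m∸n+n≡m (<⇒≤ x<B))
    (+-monoˡ-≤ x (mult-minimal (Equivalence.to (complement⇔ x) x∈S̃) (m<n⇒0<n∸m x<B)))

  -- shift the multiple (x / m + 1) * m ≤ B down by x, leaving m ∸ x % m
  mult∣assoc : ∀ {x} → Assoc S̃ x → x < B → m ∣ x
  mult∣assoc {x} x∈A x<B =
    m%n≡0⇒n∣m x m (mult∸∈⇒≡0 (m%n<n x m) (subst (_∈ₛ S) s∸x≡m∸r s∸x∈S))
    where
    r = x % m
    q = x / m
    s = suc q * m
    s∸x∈S : (s ∸ x) ∈ₛ S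
    s∸x∈S = assoc-shift x∈A (multiple∈ (n∣m*n (suc q)))
              (≤-trans (+-monoʳ-≤ m (m/n*n≤m x m)) (mult+assoc≤base x∈A x<B))
    s∸x≡m∸r : s ∸ x ≡ m ∸ r
    s∸x≡m∸r = trans (cong₂ _∸_ (+-comm m (q * m)) (trans (m≡m%n+[m/n]*n x m) (+-comm r (q * m))))
                    ([m+n]∸[m+o]≡n∸o (q * m) m r)

  -- s % m + x = s + (k ∸ q) * m lies in S below B, and shifting it down by x leaves s % m
  mult∣≤assoc : ∀ {x s} → Assoc S̃ x → x < B → s ∈ₛ S → s ≤ x → m ∣ s
  mult∣≤assoc {x} {s} x∈A x<B s∈S s≤x = m%n≡0⇒n∣m s m (∈∧<mult⇒≡0 r∈S (m%n<n s m))
    where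
    open ≡-Reasoning
    r = s % m
    q = s / m
    k = quotient (mult∣assoc x∈A x<B)
    x≡k*m : x ≡ k * m
    x≡k*m = _∣_.equality (mult∣assoc x∈A x<B)
    q≤k : q ≤ k
    q≤k = *-cancelʳ-≤ q k m (≤-trans (m/n*n≤m s m) (≤-trans s≤x (≤-reflexive x≡k*m)))
    t = s + (k ∸ q) * m
    t≡r+x : t ≡ r + x
    t≡r+x = begin
      s + (k ∸ q) * m           ≡⟨ cong (_+ (k ∸ q) * m) (m≡m%n+[m/n]*n s m) ⟩
      r + q * m + (k ∸ q) * m   ≡⟨ +-assoc r (q * m) _ ⟩
      r + (q * m + (k ∸ q) * m) ≡⟨ cong (r +_) (*-distribʳ-+ m q (k ∸ q)) ⟨
      r + (q + (k ∸ q)) * m     ≡⟨ cong (λ j → r + j * m) (m+[n∸m]≡n q≤k) ⟩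
      r + k * m                 ≡⟨ cong (r +_) x≡k*m ⟨
      r + x                     ∎
    t≤B : t ≤ B
    t≤B = ≤-trans (≤-reflexive t≡r+x)
                  (≤-trans (+-monoˡ-≤ x (<⇒≤ (m%n<n s m))) (mult+assoc≤base x∈A x<B))
    r∈S : r ∈ₛ S
    r∈S = subst (_∈ₛ S) (trans (cong (_∸ x) t≡r+x) (m+n∸n≡m r x))
                (assoc-shift x∈A (closed s _ s∈S (multiple∈ (n∣m*n (k ∸ q)))) t≤B)

  mult∣≤base : ∀ {x} → Assoc S̃ x → 0 < x → x < B → ∀ {s} → s ∈ₛ S → s ≤ B → m ∣ s
  mult∣≤base {x} x∈A x>0 x<B {s} = <-rec (λ s → s ∈ₛ S → s ≤ B → m ∣ s) step s
    where
    step : ∀ s → (∀ {y} → y < s → y ∈ₛ S → y ≤ B → m ∣ y) → s ∈ₛ S → s ≤ B → m ∣ s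
    step s rec s∈S s≤B with x <? s
    ... | no  x≮s = mult∣≤assoc x∈A x<B s∈S (≮⇒≥ x≮s)
    ... | yes x<s = ∣m∸n∣n⇒∣m m (<⇒≤ x<s)
                      (rec (∸-monoʳ-< x>0 (<⇒≤ x<s)) (assoc-shift x∈A s∈S s≤B)
                           (≤-trans (m∸n≤m s x) s≤B))
                      (mult∣assoc x∈A x<B)

  multiples-assoc : (∀ {s} → s ∈ₛ S → s ≤ B → m ∣ s) → ∀ {n} → m ∣ n → Assoc S̃ n
  multiples-assoc below∣ {n} m∣n = reflect (∣m∣n⇒∣m∸n (below∣ base∈ ≤-refl) m∣n) , n+S̃⊆S̃
    where
    reflect : ∀ {n} → m ∣ B ∸ n → S̃ n
    reflect = Equivalence.from (complement⇔ _) ∘ multiple∈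
    n+S̃⊆S̃ : ∀ t → S̃ t → S̃ (n + t)
    n+S̃⊆S̃ t t∈S̃ = reflect (subst (m ∣_) (trans (∸-+-assoc B t n) (cong (B ∸_) (+-comm t n)))
      (∣m∣n⇒∣m∸n (below∣ (Equivalence.to (complement⇔ t) t∈S̃) (m∸n≤m B t)) m∣n))

  smallAtom≡mult : ∀ {a} → IsSmallAtom (Assoc S̃) a → a ≡ m
  smallAtom≡mult a-small@(a-atom@(a∈A , a>0 , _) , _) =
    atom-multiple≡ (multiples-assoc (mult∣≤base a∈A a>0 a<B)) mult>0 a-atom (mult∣assoc a∈A a<B)
    where a<B = smallAtom<base a-small

  smallAtom-S≡mult : ∀ {c d} → IsSmallAtom (Assoc S̃) c → IsSmallAtom ⟦ S ⟧ d → d ≡ m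
  smallAtom-S≡mult c-small@((c∈A , c>0 , _) , _) (d-atom@(d∈S , _ , _) , g , g∉S , d<g) =
    atom-multiple≡ multiple∈ mult>0 d-atom
      (mult∣≤base c∈A c>0 (smallAtom<base c-small) d∈S (below-gap⇒≤ d∈S g∉S d<g))

theorem3p1 : (S : NumericalSet) → IsNumericalSemigroup S →
    (∀ a b → IsSmallAtom (Assoc (Complement S)) a →
       IsSmallAtom (Assoc (Complement S)) b → a ≡ b)
    × ((∃[ a ] ∃[ b ] (a ≢ b × IsSmallAtom ⟦ S ⟧ a × IsSmallAtom ⟦ S ⟧ b)) →
       ∀ a → ¬ IsSmallAtom (Assoc (Complement S)) a)
theorem3p1 S closed =
  (λ _ _ a-small b-small → trans (smallAtom≡mult a-small) (sym (smallAtom≡mult b-small))) ,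
  λ { (a , b , a≢b , a-small , b-small) c c-small →
        a≢b (trans (smallAtom-S≡mult c-small a-small) (sym (smallAtom-S≡mult c-small b-small))) }
  where
  open SmallAtoms closed (proj₂ (base S)) (proj₂ (multiplicity S))
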